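{- For every integer $k\geq 5$ there exists a graph $D_n$ on $n = k^2+k-1$ vertices such that $\deg(x)+\deg(y)\geq \frac{2n-2k+1}{k}$ for any two non-adjacent vertices $x$ and $y$ of $D_n$, and $D_n$ has $k-1$ cut edges.
   Context: All graphs are finite, simple and undirected; $\deg(x)$ is the degree of $x$; a cut edge is an edge whose removal disconnects the graph. -}

module Defs where

open import Data.Nat using (ℕ; _+_; _*_; _≤_; _∸_)
open import Data.Bool using (Bool; true; false; if_then_else_)
open import Data.Fin using (Fin) renaming (_<_ to _<ᶠ_)
open import Data.List using (List; map; allFin; length)
open import Data.Nat.ListAction using (sum)
open import Data.List.Membership.Propositional using (_∈_)
open import Data.List.Relation.Unary.All using (All)
open import Data.List.Relation.Unary.Unique.Propositional using (Unique)
open import Data.Product using (Σ; _×_; _,_)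
open import Relation.Binary.PropositionalEquality using (_≡_)
open import Relation.Nullary using (¬_)

record Graph (n : ℕ) : Set where
  field
    adj   : Fin n → Fin n → Bool
    sym   : ∀ x y → adj x y ≡ adj y x
    irrefl : ∀ x → adj x x ≡ false
open Graph public

Adj : ∀ {n} → Graph n → Fin n → Fin n → Set
Adj G x y = adj G x y ≡ true

deg : ∀ {n} → Graph n → Fin n → ℕ
deg {n} G x = sum (map (λ y → if adj G x y then 1 else 0) (allFin n))

data Reach {n : ℕ} (R : Fin n → Fin n → Set) : Fin n → Fin n → Set where
  here : ∀ {x} → Reach R x x
  step : ∀ {x y z} → R x y → Reach R y z → Reach R x z

AdjMinus : ∀ {n} → Graph n → Fin n → Fin n → Fin n → Fin n → Set
AdjMinus G u v a b = Adj G a b × ¬ (a ≡ u × b ≡ v) × ¬ (a ≡ v × b ≡ u)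

CutEdge : ∀ {n} → Graph n → Fin n → Fin n → Set
CutEdge G u v = Adj G u v × ¬ Reach (AdjMinus G u v) u v

HasExactlyCutEdges : ∀ {n} → Graph n → ℕ → Set
HasExactlyCutEdges {n} G m =
  Σ (List (Fin n × Fin n)) λ es →
    Unique es × length es ≡ m ×
    All (λ e → let (u , v) = e in u <ᶠ v × CutEdge G u v) es ×
    (∀ u v → u <ᶠ v → CutEdge G u v → (u , v) ∈ es)

module Submission where

-- The graph D_n is a hub with pendant cliques: a hub vertex together with
-- c = k - 1 disjoint copies of the complete graph K_d, d = k + 2, where one
-- vertex of each clique (its port) is joined to the hub.  It has
-- 1 + (k - 1)(k + 2) = k² + k - 1 vertices.
--
-- Counting neighbours
-- block by block, the hub has degree ≥ c and every member degree ≥ d - 1,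
-- so two distinct vertices have degree sum ≥ c + d - 1 whenever c < d.
-- For d ≥ 3 the cut edges are exactly the c hub–port edges: deleting one
-- leaves its block without outgoing edges, while an edge inside a block
-- lies on a triangle.  The theorem is the instance c = k - 1, d = k + 2,
-- where the degree sum of any two distinct vertices is ≥ 2k; this holds for
-- every k ≥ 1, so the hypothesis k ≥ 5 is only used to write k = 1 + k₁.

open import Defs
open import Data.Nat using (ℕ; _+_; _*_; _≤_; _∸_)
open import Data.Fin using (Fin)
open import Data.Product using (Σ; _×_)
open import Relation.Binary.PropositionalEquality using (_≡_)
open import Relation.Nullary using (¬_)

open import Function using (_∘_; id)
open import Function.Bundles using (mk⇔)
open import Data.Nat using (zero; suc; _<_; z≤n; s≤s; s≤s⁻¹; _≟_; NonZero; ≢-nonZero⁻¹)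
open import Data.Nat.Properties
open import Data.Nat.DivMod
open import Data.Nat.Divisibility using (divides-refl)
open import Data.Nat.Tactic.RingSolver using (solve-∀)
open import Algebra.Properties.CommutativeSemigroup +-commutativeSemigroup using (x∙yz≈y∙xz)
import Data.Fin as Fin
open import Data.Fin using (toℕ; fromℕ<) renaming (zero to fzero; suc to fsuc)
open import Data.Fin.Properties using (toℕ-injective; toℕ-fromℕ<; toℕ<n)
  renaming (suc-injective to fsuc-injective)
open import Data.Bool using (if_then_else_)
open import Data.List using (List; map; allFin; tabulate)
open import Data.Nat.ListAction using (sum)
open import Data.List.Properties using (map-tabulate; length-map; length-tabulate)
open import Data.List.Membership.Propositional using (_∈_)
open import Data.List.Membership.Propositional.Properties using (∈-map⁺; ∈-allFin)
import Data.List.Relation.Unary.All.Properties as All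
import Data.List.Relation.Unary.Unique.Propositional.Properties as Unique
open import Data.Product using (_,_; proj₁; proj₂)
open import Data.Empty using (⊥; ⊥-elim)
open import Relation.Binary.PropositionalEquality
  using (refl; trans; cong; cong₂; subst; _≢_; module ≡-Reasoning)
  renaming (sym to ≡-sym)
open import Relation.Nullary using (Dec; yes; no; does; _×-dec_; ¬?)
open import Relation.Nullary.Decidable using (dec-true; dec-false; does-⇔)

Σ< : ℕ → (ℕ → ℕ) → ℕ
Σ< zero    f = 0
Σ< (suc m) f = f 0 + Σ< m (f ∘ suc)

Σ<-cong : ∀ m {f g : ℕ → ℕ} → (∀ i → f i ≡ g i) → Σ< m f ≡ Σ< m g
Σ<-cong zero    f≗g = refl
Σ<-cong (suc m) f≗g = cong₂ _+_ (f≗g 0) (Σ<-cong m (f≗g ∘ suc))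

Σ<-split : ∀ m l (f : ℕ → ℕ) → Σ< (m + l) f ≡ Σ< m f + Σ< l (λ i → f (m + i))
Σ<-split zero    l f = refl
Σ<-split (suc m) l f =
  trans (cong (f 0 +_) (Σ<-split m l (f ∘ suc))) (≡-sym (+-assoc (f 0) _ _))

Σ<-blocks : ∀ c d (f : ℕ → ℕ) →
  Σ< (c * d) f ≡ Σ< c (λ b → Σ< d (λ r → f (r + b * d)))
Σ<-blocks zero    d f = refl
Σ<-blocks (suc c) d f = begin
  Σ< (d + c * d) f
    ≡⟨ Σ<-split d (c * d) f ⟩
  Σ< d f + Σ< (c * d) (λ i → f (d + i))
    ≡⟨ cong₂ _+_ (Σ<-cong d (λ r → cong f (≡-sym (+-identityʳ r))))
                 (Σ<-blocks c d (λ i → f (d + i))) ⟩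
  Σ< d (λ r → f (r + 0)) + Σ< c (λ b → Σ< d (λ r → f (d + (r + b * d))))
    ≡⟨ cong (Σ< d (λ r → f (r + 0)) +_)
            (Σ<-cong c (λ b → Σ<-cong d (λ r → cong f (x∙yz≈y∙xz d r (b * d))))) ⟩
  Σ< (suc c) (λ b → Σ< d (λ r → f (r + b * d))) ∎
  where open ≡-Reasoning

term≤Σ< : ∀ {m b} (f : ℕ → ℕ) → b < m → f b ≤ Σ< m f
term≤Σ< {suc m} {zero}  f _         = m≤m+n (f 0) _
term≤Σ< {suc m} {suc b} f (s≤s b<m) = ≤-trans (term≤Σ< (f ∘ suc) b<m) (m≤n+m _ (f 0))

Σ<-positive : ∀ m (f : ℕ → ℕ) → (∀ i → i < m → 1 ≤ f i) → m ≤ Σ< m f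
Σ<-positive zero    f _   = z≤n
Σ<-positive (suc m) f pos =
  +-mono-≤ (pos 0 (s≤s z≤n)) (Σ<-positive m (f ∘ suc) (λ i i<m → pos (suc i) (s≤s i<m)))

Σ<-positive-but-one : ∀ m r (f : ℕ → ℕ) →
  (∀ i → i < m → i ≢ r → 1 ≤ f i) → m ≤ suc (Σ< m f)
Σ<-positive-but-one zero    r       f _   = z≤n
Σ<-positive-but-one (suc m) zero    f pos =
  s≤s (≤-trans (Σ<-positive m (f ∘ suc) (λ i i<m → pos (suc i) (s≤s i<m) λ ())) (m≤n+m _ _))
Σ<-positive-but-one (suc m) (suc r) f pos =
  ≤-trans (+-mono-≤ (pos 0 (s≤s z≤n) λ ())
                    (Σ<-positive-but-one m r (f ∘ suc)
                       (λ i i<m i≢r → pos (suc i) (s≤s i<m) (i≢r ∘ suc-injective))))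
          (≤-reflexive (+-suc (f 0) _))

sum-allFin : ∀ n (h : ℕ → ℕ) → sum (map (h ∘ toℕ) (allFin n)) ≡ Σ< n h
sum-allFin n h = trans (cong sum (map-tabulate {n = n} id (h ∘ toℕ))) (sum-tabulate n h)
  where
  sum-tabulate : ∀ n (h : ℕ → ℕ) → sum (tabulate {n = n} (h ∘ toℕ)) ≡ Σ< n h
  sum-tabulate zero    h = refl
  sum-tabulate (suc n) h = cong (h 0 +_) (sum-tabulate n (h ∘ suc))

quotient-of : ∀ {r} b d .{{_ : NonZero d}} → r < d → (r + b * d) / d ≡ b
quotient-of {r} b d r<d = begin
  (r + b * d) / d    ≡⟨ +-distrib-/-∣ʳ r (divides-refl b) ⟩
  r / d + b * d / d  ≡⟨ cong₂ _+_ (m<n⇒m/n≡0 r<d) (m*n/n≡m b d) ⟩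
  b                  ∎
  where open ≡-Reasoning

remainder-of : ∀ {r} b d .{{_ : NonZero d}} → r < d → (r + b * d) % d ≡ r
remainder-of {r} b d r<d = trans ([m+kn]%n≡m%n r b d) (m<n⇒m%n≡m r<d)

index<blocks : ∀ {r b c d} → r < d → b < c → r + b * d < c * d
index<blocks {r} {b} {c} {d} r<d b<c =
  ≤-trans (+-monoˡ-< (b * d) r<d) (*-monoˡ-≤ d b<c)

avoid-two : ∀ p q → Σ ℕ λ r → r < 3 × r ≢ p × r ≢ q
avoid-two zero          zero          = 1 , s≤s (s≤s z≤n) , (λ ()) , (λ ())
avoid-two zero          (suc zero)    = 2 , s≤s (s≤s (s≤s z≤n)) , (λ ()) , (λ ())
avoid-two zero          (suc (suc q)) = 1 , s≤s (s≤s z≤n) , (λ ()) , (λ ())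
avoid-two (suc zero)    zero          = 2 , s≤s (s≤s (s≤s z≤n)) , (λ ()) , (λ ())
avoid-two (suc (suc p)) zero          = 1 , s≤s (s≤s z≤n) , (λ ()) , (λ ())
avoid-two (suc p)       (suc q)       = 0 , s≤s z≤n , (λ ()) , (λ ())

Reach-invariant : ∀ {n} {R : Fin n → Fin n → Set} (P : Fin n → Set) →
  (∀ {a b} → R a b → P a → P b) → ∀ {x y} → Reach R x y → P x → P y
Reach-invariant P closed here          px = px
Reach-invariant P closed (step r walk) px = Reach-invariant P closed walk (closed r px)

-- The hub with c pendant cliques K_d.  Index 0 is the hub and index
-- 1 + i, i < c·d, is member i % d of block i / d; the port of a block is its
-- member 0.
module HubWithCliques (c d : ℕ) .{{_ : NonZero d}} where

  N : ℕ
  N = suc (c * d)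

  0<d : 0 < d
  0<d = n≢0⇒n>0 (≢-nonZero⁻¹ d)

  Link : ℕ → ℕ → Set
  Link zero    zero    = ⊥
  Link zero    (suc j) = j % d ≡ 0
  Link (suc i) zero    = i % d ≡ 0
  Link (suc i) (suc j) = i / d ≡ j / d × i ≢ j

  link? : ∀ i j → Dec (Link i j)
  link? zero    zero    = no id
  link? zero    (suc j) = j % d ≟ 0
  link? (suc i) zero    = i % d ≟ 0
  link? (suc i) (suc j) = (i / d ≟ j / d) ×-dec ¬? (i ≟ j)

  Link-sym : ∀ {i j} → Link i j → Link j i
  Link-sym {zero}  {suc j} p                  = p
  Link-sym {suc i} {zero}  p                  = p
  Link-sym {suc i} {suc j} (same-block , i≢j) = ≡-sym same-block , i≢j ∘ ≡-sym

  Link-irrefl : ∀ i → ¬ Link i i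
  Link-irrefl zero    ()
  Link-irrefl (suc i) (_ , i≢i) = i≢i refl

  H : Graph N
  H = record
    { adj    = λ x y → does (link? (toℕ x) (toℕ y))
    ; sym    = λ x y → does-⇔ (mk⇔ Link-sym Link-sym)
                                (link? (toℕ x) (toℕ y)) (link? (toℕ y) (toℕ x))
    ; irrefl = λ x → dec-false (link? _ _) (Link-irrefl (toℕ x))
    }

  hub : Fin N
  hub = fzero

  Adj⇒Link : ∀ {x y} → Adj H x y → Link (toℕ x) (toℕ y)
  Adj⇒Link {x} {y} adj with link? (toℕ x) (toℕ y)
  ... | yes link = link

  Link⇒Adj : ∀ {x y} → Link (toℕ x) (toℕ y) → Adj H x y
  Link⇒Adj {x} {y} = dec-true (link? (toℕ x) (toℕ y))

  ι : ℕ → ℕ → ℕ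
  ι i j = if does (link? i j) then 1 else 0

  ι-link : ∀ i j → Link i j → 1 ≤ ι i j
  ι-link i j link rewrite dec-true (link? i j) link = ≤-refl

  deg≥blocks : ∀ x → Σ< c (λ b → Σ< d (λ r → ι (toℕ x) (suc (r + b * d)))) ≤ deg H x
  deg≥blocks x = begin
    Σ< c (λ b → Σ< d (λ r → ι (toℕ x) (suc (r + b * d))))
      ≡⟨ ≡-sym (Σ<-blocks c d (ι (toℕ x) ∘ suc)) ⟩
    Σ< (c * d) (ι (toℕ x) ∘ suc)
      ≤⟨ m≤n+m _ _ ⟩
    Σ< N (ι (toℕ x))
      ≡⟨ ≡-sym (sum-allFin N (ι (toℕ x))) ⟩
    deg H x ∎
    where open ≤-Reasoning

  -- The hub is adjacent to the port of each of the c blocks.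
  deg-hub : c ≤ deg H hub
  deg-hub = ≤-trans (Σ<-positive c _ λ b _ → port-counted b) (deg≥blocks hub)
    where
    port-counted : ∀ b → 1 ≤ Σ< d (λ r → ι 0 (suc (r + b * d)))
    port-counted b = ≤-trans (ι-link 0 (suc (b * d)) (m*n%n≡0 b d))
                             (term≤Σ< _ 0<d)

  -- A member is adjacent to the d - 1 other members of its block.
  deg-member : ∀ (i : Fin (c * d)) → d ≤ suc (deg H (fsuc i))
  deg-member i = begin
    d
      ≤⟨ Σ<-positive-but-one d (toℕ i % d) _ other-member-counted ⟩
    suc (Σ< d (λ r → ι (suc (toℕ i)) (suc (r + b * d))))
      ≤⟨ s≤s (term≤Σ< (λ b → Σ< d (λ r → ι (suc (toℕ i)) (suc (r + b * d))))
                      (m<n*o⇒m/o<n {n = c} (toℕ<n i))) ⟩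
    suc (Σ< c (λ b → Σ< d (λ r → ι (suc (toℕ i)) (suc (r + b * d)))))
      ≤⟨ s≤s (deg≥blocks (fsuc i)) ⟩
    suc (deg H (fsuc i)) ∎
    where
    open ≤-Reasoning
    b = toℕ i / d
    other-member-counted : ∀ r → r < d → r ≢ toℕ i % d → 1 ≤ ι (suc (toℕ i)) (suc (r + b * d))
    other-member-counted r r<d r≢i%d = ι-link (suc (toℕ i)) (suc (r + b * d))
      ( ≡-sym (quotient-of b d r<d)
      , λ i≡member → r≢i%d (trans (≡-sym (remainder-of b d r<d)) (cong (_% d) (≡-sym i≡member))))

  -- Two distinct vertices include at most one hub, so when c < d their
  -- degrees sum to at least c + d - 1.
  deg-sum : c < d → ∀ x y → x ≢ y → c + d ≤ suc (deg H x + deg H y)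
  deg-sum _   fzero    fzero    x≢y = ⊥-elim (x≢y refl)
  deg-sum _   fzero    (fsuc j) _   =
    ≤-trans (+-mono-≤ deg-hub (deg-member j)) (≤-reflexive (+-suc _ _))
  deg-sum _   (fsuc i) fzero    _   =
    ≤-trans (≤-reflexive (+-comm c d)) (+-mono-≤ (deg-member i) deg-hub)
  deg-sum c<d (fsuc i) (fsuc j) _   = s≤s⁻¹ (begin
    suc (c + d)                           ≤⟨ +-monoˡ-< d c<d ⟩
    d + d                                 ≤⟨ +-mono-≤ (deg-member i) (deg-member j) ⟩
    suc (deg H (fsuc i)) + suc (deg H (fsuc j)) ≡⟨ cong suc (+-suc _ _) ⟩
    suc (suc (deg H (fsuc i) + deg H (fsuc j))) ∎)
    where open ≤-Reasoning

  port : Fin c → Fin N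
  port b = fsuc (fromℕ< (index<blocks {0} 0<d (toℕ<n b)))

  toℕ-port : ∀ b → toℕ (port b) ≡ suc (toℕ b * d)
  toℕ-port b = cong suc (toℕ-fromℕ< _)

  port-injective : ∀ {a b} → port a ≡ port b → a ≡ b
  port-injective {a} {b} eq = toℕ-injective (*-cancelʳ-≡ (toℕ a) (toℕ b) d
    (suc-injective (trans (≡-sym (toℕ-port a)) (trans (cong toℕ eq) (toℕ-port b)))))

  port-unique : ∀ b (j : Fin (c * d)) → toℕ j % d ≡ 0 → toℕ j / d ≡ toℕ b → port b ≡ fsuc j
  port-unique b j j%d≡0 j/d≡b = cong fsuc (toℕ-injective (begin
    toℕ (fromℕ< _)            ≡⟨ toℕ-fromℕ< _ ⟩
    toℕ b * d                 ≡⟨ cong₂ (λ r q → r + q * d) (≡-sym j%d≡0) (≡-sym j/d≡b) ⟩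
    toℕ j % d + toℕ j / d * d ≡⟨ ≡-sym (m≡m%n+[m/n]*n (toℕ j) d) ⟩
    toℕ j                     ∎))
    where open ≡-Reasoning

  -- After deleting the edge hub–port b, no edge leaves block b, so the hub
  -- cannot reach the port: the edge is a cut edge.
  hub-port-cut : ∀ b → CutEdge H hub (port b)
  hub-port-cut b = Link⇒Adj {hub} {port b} port-link
                 , λ walk → Reach-invariant Outside closed walk (λ ()) port-inside
    where
    InBlock : ℕ → Set
    InBlock zero    = ⊥
    InBlock (suc i) = i / d ≡ toℕ b

    Outside : Fin N → Set
    Outside w = ¬ InBlock (toℕ w)

    port-link : Link 0 (toℕ (port b))
    port-link = trans (cong (_% d) (toℕ-fromℕ< _)) (m*n%n≡0 (toℕ b) d)

    port-inside : InBlock (toℕ (port b))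
    port-inside = trans (cong (_/ d) (toℕ-fromℕ< _)) (m*n/n≡m (toℕ b) d)

    closed : ∀ {w w'} → AdjMinus H hub (port b) w w' → Outside w → Outside w'
    closed {w'     = fzero}  _                  _       ()
    closed {fzero} {fsuc j} (adj , not-deleted , _) _ j∈b =
      not-deleted (refl , ≡-sym (port-unique b j (Adj⇒Link {hub} {fsuc j} adj) j∈b))
    closed {fsuc i} {fsuc j} (adj , _) i∉b j∈b =
      i∉b (trans (proj₁ (Adj⇒Link {fsuc i} {fsuc j} adj)) j∈b)

  third-member : 3 ≤ d → ∀ (i j : Fin (c * d)) →
    Σ (Fin (c * d)) λ w → toℕ w / d ≡ toℕ i / d × w ≢ i × w ≢ j
  third-member 3≤d i j = w , w-block , ≢-by-remainder r≢i%d , ≢-by-remainder r≢j%d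
    where
    b = toℕ i / d
    avoided = avoid-two (toℕ i % d) (toℕ j % d)
    r = proj₁ avoided
    r<d : r < d
    r<d = ≤-trans (proj₁ (proj₂ avoided)) 3≤d
    r≢i%d = proj₁ (proj₂ (proj₂ avoided))
    r≢j%d = proj₂ (proj₂ (proj₂ avoided))
    w : Fin (c * d)
    w = fromℕ< (index<blocks r<d (m<n*o⇒m/o<n {n = c} (toℕ<n i)))
    w-block : toℕ w / d ≡ b
    w-block = trans (cong (_/ d) (toℕ-fromℕ< _)) (quotient-of b d r<d)
    ≢-by-remainder : ∀ {v : Fin (c * d)} → r ≢ toℕ v % d → w ≢ v
    ≢-by-remainder {v} r≢v%d w≡v = r≢v%d (begin
      r                   ≡⟨ ≡-sym (remainder-of b d r<d) ⟩
      (r + b * d) % d     ≡⟨ cong (_% d) (≡-sym (toℕ-fromℕ< _)) ⟩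
      toℕ w % d           ≡⟨ cong (λ u → toℕ u % d) w≡v ⟩
      toℕ v % d           ∎)
      where open ≡-Reasoning

  -- For d ≥ 3 an edge inside a block lies on a triangle, so it is not a cut edge.
  block-edge-not-cut : 3 ≤ d → ∀ i j → ¬ CutEdge H (fsuc i) (fsuc j)
  block-edge-not-cut 3≤d i j (adj , no-detour) =
    no-detour (step first-leg (step second-leg here))
    where
    same-block = proj₁ (Adj⇒Link {fsuc i} {fsuc j} adj)
    i≢j : i ≢ j
    i≢j i≡j = proj₂ (Adj⇒Link {fsuc i} {fsuc j} adj) (cong toℕ i≡j)
    third = third-member 3≤d i j
    w = proj₁ third
    w-block = proj₁ (proj₂ third)
    w≢i = proj₁ (proj₂ (proj₂ third))
    w≢j = proj₂ (proj₂ (proj₂ third))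
    first-leg : AdjMinus H (fsuc i) (fsuc j) (fsuc i) (fsuc w)
    first-leg = Link⇒Adj {fsuc i} {fsuc w} (≡-sym w-block , w≢i ∘ ≡-sym ∘ toℕ-injective)
              , (λ (_ , w≡j) → w≢j (fsuc-injective w≡j))
              , (λ (i≡j , _) → i≢j (fsuc-injective i≡j))
    second-leg : AdjMinus H (fsuc i) (fsuc j) (fsuc w) (fsuc j)
    second-leg = Link⇒Adj {fsuc w} {fsuc j} (trans w-block same-block , w≢j ∘ toℕ-injective)
               , (λ (w≡i , _) → w≢i (fsuc-injective w≡i))
               , (λ (w≡j , _) → w≢j (fsuc-injective w≡j))

  port-edges : List (Fin N × Fin N)
  port-edges = map (λ b → hub , port b) (allFin c)

  hub-edge-is-port-edge : ∀ j → Adj H hub (fsuc j) → (hub , fsuc j) ∈ port-edges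
  hub-edge-is-port-edge j adj =
    subst (λ v → (hub , v) ∈ port-edges)
          (port-unique b j (Adj⇒Link {hub} {fsuc j} adj) (≡-sym (toℕ-fromℕ< _)))
          (∈-map⁺ (λ b → hub , port b) (∈-allFin b))
    where
    b : Fin c
    b = fromℕ< (m<n*o⇒m/o<n {n = c} (toℕ<n j))

  cut-edges : 3 ≤ d → HasExactlyCutEdges H c
  cut-edges 3≤d =
    port-edges
    , Unique.map⁺ (port-injective ∘ cong proj₂) (Unique.allFin⁺ c)
    , trans (length-map _ (allFin c)) (length-tabulate id)
    , All.map⁺ (All.tabulate⁺ λ b → s≤s z≤n , hub-port-cut b)
    , only-port-edges
    where
    only-port-edges : ∀ u v → u Fin.< v → CutEdge H u v → (u , v) ∈ port-edges
    only-port-edges fzero    (fsuc j) _ (adj , _) = hub-edge-is-port-edge j adj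
    only-port-edges (fsuc i) (fsuc j) _ cut       = ⊥-elim (block-edge-not-cut 3≤d i j cut)

vertex-count : ∀ k₁ → suc k₁ * suc k₁ + suc k₁ ∸ 1 ≡ suc (k₁ * (3 + k₁))
vertex-count k₁ = cong (_∸ 1) (lemma k₁)
  where
  lemma : ∀ k₁ → suc k₁ * suc k₁ + suc k₁ ≡ suc (suc (k₁ * (3 + k₁)))
  lemma = solve-∀

-- On n = k² + k - 1 vertices, a degree sum of at least 2k suffices:
-- 2n + 1 = 2k² + 2k - 1 < k · 2k + 2k.
degree-bound : ∀ k₁ s → 2 * suc k₁ ≤ s →
  2 * suc (k₁ * (3 + k₁)) + 1 ≤ suc k₁ * s + 2 * suc k₁
degree-bound k₁ s 2k≤s =
  ≤-trans (≤-trans (n≤1+n _) (≤-reflexive (identity k₁)))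
          (+-monoˡ-≤ (2 * suc k₁) (*-monoʳ-≤ (suc k₁) 2k≤s))
  where
  identity : ∀ k₁ → suc (2 * suc (k₁ * (3 + k₁)) + 1) ≡ suc k₁ * (2 * suc k₁) + 2 * suc k₁
  identity = solve-∀

theorem3p5 : (k : ℕ) → 5 ≤ k →
    Σ (Graph (k * k + k ∸ 1)) λ D →
      (∀ x y → ¬ x ≡ y → ¬ Adj D x y →
        2 * (k * k + k ∸ 1) + 1 ≤ k * (deg D x + deg D y) + 2 * k)
      × HasExactlyCutEdges D (k ∸ 1)
theorem3p5 (suc k₁) _ =
  subst Witness (≡-sym (vertex-count k₁)) (H , degree-condition , cut-edges 3≤d)
  where
  open HubWithCliques k₁ (3 + k₁)

  Witness : ℕ → Set
  Witness n = Σ (Graph n) λ D →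
    (∀ x y → ¬ x ≡ y → ¬ Adj D x y →
      2 * n + 1 ≤ suc k₁ * (deg D x + deg D y) + 2 * suc k₁)
    × HasExactlyCutEdges D k₁

  3≤d : 3 ≤ 3 + k₁
  3≤d = m≤m+n 3 k₁

  -- Any two distinct vertices have degree sum ≥ (k - 1) + (k + 2) - 1 = 2k.
  degree-condition : ∀ x y → ¬ x ≡ y → ¬ Adj H x y →
    2 * N + 1 ≤ suc k₁ * (deg H x + deg H y) + 2 * suc k₁
  degree-condition x y x≢y _ = degree-bound k₁ (deg H x + deg H y)
    (s≤s⁻¹ (≤-trans (≤-reflexive (one-plus-2k k₁)) (deg-sum (m<n+m k₁ (s≤s z≤n)) x y x≢y)))
    where
    one-plus-2k : ∀ k₁ → suc (2 * suc k₁) ≡ k₁ + (3 + k₁)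
    one-plus-2k = solve-∀
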